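{- For every InqML-formula $\varphi$ there are two-sorted first-order formulae $\varphi^\star_{\mathtt w}(\mathtt w)$ (one free world variable) and $\varphi^\star_{\mathtt s}(\mathtt s)$ (one free state variable) such that for every inquisitive modal model $\mathcal{M}$, every relational encoding $\mathfrak{M}$ of $\mathcal{M}$ (not necessarily locally full), all worlds $w\in W$ and all states $s\in S$ of $\mathfrak{M}$: (i) $\mathcal{M},w\models\varphi$ iff $\mathfrak{M}\models\varphi^\star_{\mathtt w}[w]$; (ii) $\mathcal{M},s\models\varphi$ iff $\mathfrak{M}\models\varphi^\star_{\mathtt s}[s]$.
   Context: Inquisitive modal model over atoms $\mathcal{P}=\{p_i:i\in I\}$: $\mathcal{M}=(W,\Sigma,V)$, $V:\mathcal{P}\to\wp(W)$, each $\Sigma(w)$ a non-empty subset-closed family of subsets of $W$; $\sigma(w):=\bigcup\Sigma(w)$. InqML: $\varphi::=p\mid\bot\mid\varphi\wedge\varphi\mid\varphi\to\varphi\mid\varphi\bar\vee\varphi\mid\Box\varphi\mid\boxplus\varphi$ with support: $s\models p$ iff $s\subseteq V(p)$; $s\models\bot$ iff $s=\emptyset$; $\wedge$ componentwise; $s\models\varphi\to\psi$ iff every $t\subseteq s$ supporting $\varphi$ supports $\psi$; $s\models\varphi\bar\vee\psi$ iff $s$ supports $\varphi$ or $\psi$; $s\models\Box\varphi$ iff $\sigma(w)\models\varphi$ for all $w\in s$; $s\models\boxplus\varphi$ iff every $t\in\Sigma(w)$, $w\in s$, supports $\varphi$. $\mathcal{M},w\models\varphi$ iff $\mathcal{M},\{w\}\models\varphi$.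 A relational encoding of $\mathcal{M}$ is a two-sorted structure $\mathfrak{M}=(W,S,E,\in,(P_i)_{i\in I})$ with the same set $W$, a non-empty set $S$ of subsets of $W$ closed under subsets of its members, $\in$ the membership relation, $E\subseteq W\times S$ with $E[w]=\Sigma(w)$ for all $w$, and $P_i=V(p_i)$. The first-order language is two-sorted with binary symbols $\mathtt E$, $\epsilon$ between the world and state sorts and unary $\mathtt P_i$ on the world sort. -}

module Defs where

open import Level using (Level; Lift; lift; lower) renaming (zero to lzero; suc to lsuc)
open import Data.Empty using (⊥)
open import Data.Unit using (⊤)
open import Data.Product using (Σ; ∃; _×_; _,_; proj₁; proj₂)
open import Data.Sum using (_⊎_)
open import Data.List using (List; []; _∷_)
open import Relation.Binary.PropositionalEquality using (_≡_)
open import Function.Bundles using (_⇔_)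

_⊆ₛ_ : ∀ {a ℓ₁ ℓ₂} {A : Set a} → (A → Set ℓ₁) → (A → Set ℓ₂) → Set (a Level.⊔ ℓ₁ Level.⊔ ℓ₂)
s ⊆ₛ t = ∀ x → s x → t x

infixr 6 _∧ᵢ_
infixr 5 _∨ᵢ_
infixr 4 _⇒ᵢ_

data InqForm (I : Set) : Set where
  atom  : I → InqForm I
  ⊥ᵢ    : InqForm I
  _∧ᵢ_  : InqForm I → InqForm I → InqForm I
  _⇒ᵢ_  : InqForm I → InqForm I → InqForm I
  _∨ᵢ_  : InqForm I → InqForm I → InqForm I
  □_    : InqForm I → InqForm I
  ⊞_    : InqForm I → InqForm I

record InqModel (I : Set) : Set₁ where
  field
    W        : Set
    Σᵢ       : W → (W → Set) → Set
    V        : I → W → Set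
    Σ-nonempty : ∀ w → ∃ λ (t : W → Set) → Σᵢ w t
    Σ-closed   : ∀ w (s t : W → Set) → Σᵢ w s → t ⊆ₛ s → Σᵢ w t

  σ : W → W → Set₁
  σ w v = ∃ λ (t : W → Set) → Σᵢ w t × t v

  ↑ : (W → Set) → W → Set₁
  ↑ t v = Lift (lsuc lzero) (t v)

  single : W → W → Set₁
  single w v = Lift (lsuc lzero) (v ≡ w)

  -- support relation; states are arbitrary subsets (predicates W → Set₁)
  infix 3 _⊩_
  _⊩_ : (W → Set₁) → InqForm I → Set₂
  s ⊩ atom p   = Lift _ (s ⊆ₛ V p)
  s ⊩ ⊥ᵢ       = Lift _ (∀ w → s w → ⊥)
  s ⊩ φ ∧ᵢ ψ   = (s ⊩ φ) × (s ⊩ ψ)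
  s ⊩ φ ⇒ᵢ ψ   = ∀ (t : W → Set₁) → t ⊆ₛ s → t ⊩ φ → t ⊩ ψ
  s ⊩ φ ∨ᵢ ψ   = (s ⊩ φ) ⊎ (s ⊩ ψ)
  s ⊩ □ φ      = ∀ w → s w → σ w ⊩ φ
  s ⊩ ⊞ φ      = ∀ w → s w → ∀ (t : W → Set) → Σᵢ w t → ↑ t ⊩ φ

  _⊨w_ : W → InqForm I → Set₂
  w ⊨w φ = single w ⊩ φ

-- Relational encodings  𝔐 = (W, S, E, ∈, (P_i))  of M.
-- W, ∈ and P_i = V(p_i) are fixed by M; S is a set of subsets of W
-- (given as a predicate on subsets), E a relation between worlds and S.

record Encoding {I : Set} (M : InqModel I) : Set₂ where
  open InqModel M
  field
    S          : (W → Set) → Set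
    S-nonempty : ∃ λ (s : W → Set) → S s
    S-closed   : ∀ (s t : W → Set) → S s → t ⊆ₛ s → S t

  State : Set₁
  State = Σ (W → Set) S

  field
    E      : W → State → Set
    E-spec : ∀ w (s : State) → E w s ⇔ Σᵢ w (proj₁ s)
    Σ⊆S    : ∀ w (t : W → Set) → Σᵢ w t → S t

data Sort : Set where
  world state : Sort

Ctx : Set
Ctx = List Sort

data Var : Ctx → Sort → Set where
  vz : ∀ {Γ σ} → Var (σ ∷ Γ) σ
  vs : ∀ {Γ σ τ} → Var Γ σ → Var (τ ∷ Γ) σ

data FO (I : Set) (Γ : Ctx) : Set where
  Eₐ    : Var Γ world → Var Γ state → FO I Γ
  ∈ₐ    : Var Γ world → Var Γ state → FO I Γ
  Pₐ    : I → Var Γ world → FO I Γ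
  ≐ₐ    : ∀ {σ} → Var Γ σ → Var Γ σ → FO I Γ
  ⊥ₒ    : FO I Γ
  _∧ₒ_  : FO I Γ → FO I Γ → FO I Γ
  _∨ₒ_  : FO I Γ → FO I Γ → FO I Γ
  _⇒ₒ_  : FO I Γ → FO I Γ → FO I Γ
  ∀ₒ    : (σ : Sort) → FO I (σ ∷ Γ) → FO I Γ
  ∃ₒ    : (σ : Sort) → FO I (σ ∷ Γ) → FO I Γ

module FOSem {I : Set} {M : InqModel I} (𝔐 : Encoding M) where
  open InqModel M
  open Encoding 𝔐

  Dom : Sort → Set₁
  Dom world = Lift (lsuc lzero) W
  Dom state = State

  Env : Ctx → Set₁
  Env Γ = ∀ {σ} → Var Γ σ → Dom σ

  extend : ∀ {Γ σ} → Dom σ → Env Γ → Env (σ ∷ Γ)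
  extend d ρ vz     = d
  extend d ρ (vs x) = ρ x

  Eq : ∀ σ → Dom σ → Dom σ → Set₁
  Eq world v u = Lift _ (lower v ≡ lower u)
  Eq state s t = Lift _ ((proj₁ s ⊆ₛ proj₁ t) × (proj₁ t ⊆ₛ proj₁ s))

  ⟦_⟧ : ∀ {Γ} → FO I Γ → Env Γ → Set₁
  ⟦ Eₐ x y ⟧ ρ   = Lift _ (E (lower (ρ x)) (ρ y))
  ⟦ ∈ₐ x y ⟧ ρ   = Lift _ (proj₁ (ρ y) (lower (ρ x)))
  ⟦ Pₐ i x ⟧ ρ   = Lift _ (V i (lower (ρ x)))
  ⟦ ≐ₐ {σ} x y ⟧ ρ = Eq σ (ρ x) (ρ y)
  ⟦ ⊥ₒ ⟧ ρ       = Lift _ ⊥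
  ⟦ φ ∧ₒ ψ ⟧ ρ   = ⟦ φ ⟧ ρ × ⟦ ψ ⟧ ρ
  ⟦ φ ∨ₒ ψ ⟧ ρ   = ⟦ φ ⟧ ρ ⊎ ⟦ ψ ⟧ ρ
  ⟦ φ ⇒ₒ ψ ⟧ ρ   = ⟦ φ ⟧ ρ → ⟦ ψ ⟧ ρ
  ⟦ ∀ₒ σ φ ⟧ ρ   = ∀ (d : Dom σ) → ⟦ φ ⟧ (extend d ρ)
  ⟦ ∃ₒ σ φ ⟧ ρ   = Σ (Dom σ) λ d → ⟦ φ ⟧ (extend d ρ)

  _⊨[_] : ∀ {σ} → FO I (σ ∷ []) → Dom σ → Set₁
  φ ⊨[ d ] = ⟦ φ ⟧ (extend d (λ ()))

_⊨FO_[w≔_] : ∀ {I} {M : InqModel I} (𝔐 : Encoding M) → FO I (world ∷ []) → InqModel.W M → Set₁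
𝔐 ⊨FO φ [w≔ w ] = FOSem._⊨[_] 𝔐 φ (lift w)

_⊨FO_[s≔_] : ∀ {I} {M : InqModel I} (𝔐 : Encoding M) → FO I (state ∷ []) → Encoding.State 𝔐 → Set₁
𝔐 ⊨FO φ [s≔ s ] = FOSem._⊨[_] 𝔐 φ s

{-# OPTIONS --safe #-}
-- Every InqML formula is equivalent to the inquisitive disjunction of its
-- resolutions, which are truth-conditional: a state supports φ iff all of its
-- worlds make one common resolution of φ true. Truth of a resolution at a world
-- is first-order by a standard translation that quantifies only over worlds and
-- over the states in E[w] = Σ(w), so the encoding need not be locally full.
module Submission where

open import Defs
open import Level using (Lift; lift; lower)
open import Data.Empty using (⊥; ⊥-elim)
open import Data.Product using (Σ; _×_; _,_; proj₁; proj₂; uncurry)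
open import Data.Product.Function.NonDependent.Propositional using (_×-⇔_)
open import Data.Sum using (_⊎_)
open import Data.Sum.Function.Propositional using (_⊎-⇔_)
open import Data.List using (List; []; _∷_; [_]; _++_; map; foldr; cartesianProductWith)
open import Data.List.Relation.Unary.Any as Any using (Any; here; there)
import Data.List.Relation.Unary.Any.Properties as Anyₚ
open import Function using (_∘_)
open import Function.Bundles using (_⇔_; mk⇔; Equivalence)
open import Function.Properties.Equivalence using ()
  renaming (refl to ⇔-refl; sym to ⇔-sym; trans to ⇔-trans)
open import Function.Properties.Inverse using (↔⇒⇔)
open import Function.Related.Propositional using (K-refl)
open import Function.Related.TypeIsomorphisms using (→-cong-⇔)
open import Relation.Binary.PropositionalEquality using (refl)

open Equivalence using (to; from)

Any-cong-⇔ : ∀ {a p q} {A : Set a} {P : A → Set p} {Q : A → Set q} {xs : List A} →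
  (∀ x → P x ⇔ Q x) → Any P xs ⇔ Any Q xs
Any-cong-⇔ P⇔Q = Anyₚ.Any-cong P⇔Q K-refl

infixr 6 _∧ᶠ_
infixr 5 _⇒ᶠ_

-- The truth-conditional fragment of InqML. □ᶠ R and ⊞ᶠ R stand for □ and ⊞
-- applied to the inquisitive disjunction of the list R.
data Flat (I : Set) : Set where
  atomᶠ     : I → Flat I
  ⊥ᶠ        : Flat I
  _∧ᶠ_ _⇒ᶠ_ : Flat I → Flat I → Flat I
  □ᶠ ⊞ᶠ     : List (Flat I) → Flat I

module _ {I : Set} where

  ⊤ᶠ : Flat I
  ⊤ᶠ = ⊥ᶠ ⇒ᶠ ⊥ᶠ

  -- One conjunction ⋀_{a ∈ as} (a ⇒ᶠ f a) for each choice function f : as → bs.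
  implications : List (Flat I) → List (Flat I) → List (Flat I)
  implications []       bs = [ ⊤ᶠ ]
  implications (a ∷ as) bs = cartesianProductWith _∧ᶠ_ (map (a ⇒ᶠ_) bs) (implications as bs)

  resolutions : InqForm I → List (Flat I)
  resolutions (atom p) = [ atomᶠ p ]
  resolutions ⊥ᵢ       = [ ⊥ᶠ ]
  resolutions (φ ∧ᵢ ψ) = cartesianProductWith _∧ᶠ_ (resolutions φ) (resolutions ψ)
  resolutions (φ ⇒ᵢ ψ) = implications (resolutions φ) (resolutions ψ)
  resolutions (φ ∨ᵢ ψ) = resolutions φ ++ resolutions ψ
  resolutions (□ φ)    = [ □ᶠ (resolutions φ) ]
  resolutions (⊞ φ)    = [ ⊞ᶠ (resolutions φ) ]

module FlatSemantics {I : Set} (M : InqModel I) where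
  open InqModel M

  infix 4 _⊨ᶠ_ _⊫_ _⊨ᶠ*_

  mutual
    _⊨ᶠ_ : W → Flat I → Set₁
    w ⊨ᶠ atomᶠ p = Lift _ (V p w)
    w ⊨ᶠ ⊥ᶠ      = Lift _ ⊥
    w ⊨ᶠ a ∧ᶠ b  = w ⊨ᶠ a × w ⊨ᶠ b
    w ⊨ᶠ a ⇒ᶠ b  = w ⊨ᶠ a → w ⊨ᶠ b
    w ⊨ᶠ □ᶠ R    = σ w ⊫ R
    w ⊨ᶠ ⊞ᶠ R    = ∀ t → Σᵢ w t → ↑ t ⊫ R

    _⊫_ : (W → Set₁) → List (Flat I) → Set₁
    s ⊫ []    = Lift _ ⊥
    s ⊫ a ∷ R = (∀ v → s v → v ⊨ᶠ a) ⊎ s ⊫ R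

  _⊨ᶠ*_ : (W → Set₁) → Flat I → Set₁
  s ⊨ᶠ* a = ∀ v → s v → v ⊨ᶠ a

  ⊫⇔Any : ∀ {s} R → s ⊫ R ⇔ Any (s ⊨ᶠ*_) R
  ⊫⇔Any []      = mk⇔ (λ ()) (λ ())
  ⊫⇔Any (a ∷ R) = ⇔-trans (⇔-refl ⊎-⇔ ⊫⇔Any R) (↔⇒⇔ (Anyₚ.∷↔ _))

  single⊨ᶠ*⇔⊨ᶠ : ∀ w a → single w ⊨ᶠ* a ⇔ w ⊨ᶠ a
  single⊨ᶠ*⇔⊨ᶠ w a = mk⇔ (λ h → h w (lift refl)) (λ { h v (lift refl) → h })

  ↑Σ⊨ᶠ*⇔σ⊨ᶠ* : ∀ w a → (∀ t → Σᵢ w t → ↑ t ⊨ᶠ* a) ⇔ σ w ⊨ᶠ* a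
  ↑Σ⊨ᶠ*⇔σ⊨ᶠ* w a = mk⇔ (λ h v (t , Σt , tv) → h t Σt v (lift tv))
                        (λ h t Σt v (lift tv) → h v (t , Σt , tv))

  Any-∧ᶠ : ∀ {s} R R′ →
    Any (s ⊨ᶠ*_) (cartesianProductWith _∧ᶠ_ R R′) ⇔ (Any (s ⊨ᶠ*_) R × Any (s ⊨ᶠ*_) R′)
  Any-∧ᶠ R R′ = mk⇔
    (Anyₚ.cartesianProductWith⁻ _∧ᶠ_ (λ h → (λ v sv → proj₁ (h v sv)) , (λ v sv → proj₂ (h v sv))) R R′)
    (uncurry (Anyₚ.cartesianProductWith⁺ _∧ᶠ_ (λ g h v sv → g v sv , h v sv)))

  -- It suffices to test the premise at s ∩ ‖a‖, the largest substate of s supporting the flat a.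
  Any-⇒ᶠ : ∀ {s} a bs →
    (∀ u → u ⊆ₛ s → u ⊨ᶠ* a → Any (u ⊨ᶠ*_) bs) ⇔ Any (s ⊨ᶠ*_) (map (a ⇒ᶠ_) bs)
  Any-⇒ᶠ {s} a bs = mk⇔
    (λ h → Anyₚ.map⁺ (Any.map (λ g v sv av → g v (sv , av))
                              (h (λ v → s v × v ⊨ᶠ a) (λ _ → proj₁) (λ _ → proj₂))))
    (λ h u u⊆s ua → Any.map (λ g v uv → g v (u⊆s v uv) (ua v uv)) (Anyₚ.map⁻ h))

  Any-implications : ∀ {s} as bs →
    (∀ u → u ⊆ₛ s → Any (u ⊨ᶠ*_) as → Any (u ⊨ᶠ*_) bs) ⇔ Any (s ⊨ᶠ*_) (implications as bs)
  Any-implications []       bs = mk⇔ (λ _ → here (λ _ _ z → z)) (λ _ _ _ ())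
  Any-implications (a ∷ as) bs = ⇔-trans split
    (⇔-trans (Any-⇒ᶠ a bs ×-⇔ Any-implications as bs) (⇔-sym (Any-∧ᶠ _ _)))
    where
    split = mk⇔ (λ h → (λ u u⊆s → h u u⊆s ∘ here) , (λ u u⊆s → h u u⊆s ∘ there))
                (λ { (h , _) u u⊆s (here p) → h u u⊆s p ; (_ , h) u u⊆s (there p) → h u u⊆s p })

  Any-singleton : ∀ {s} a → s ⊨ᶠ* a ⇔ Any (s ⊨ᶠ*_) [ a ]
  Any-singleton a = mk⇔ Anyₚ.singleton⁺ Anyₚ.singleton⁻

  ⊩⇔Any-resolutions : ∀ φ s → (s ⊩ φ) ⇔ Any (s ⊨ᶠ*_) (resolutions φ)
  ⊩⇔Any-resolutions (atom p) s = ⇔-trans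
    (mk⇔ (λ (lift h) v sv → lift (h v sv)) (λ h → lift (λ v sv → lower (h v sv))))
    (Any-singleton _)
  ⊩⇔Any-resolutions ⊥ᵢ s = ⇔-trans
    (mk⇔ (λ (lift h) v sv → ⊥-elim (h v sv)) (λ h → lift (λ v sv → lower (h v sv))))
    (Any-singleton _)
  ⊩⇔Any-resolutions (φ ∧ᵢ ψ) s = ⇔-trans
    (⊩⇔Any-resolutions φ s ×-⇔ ⊩⇔Any-resolutions ψ s) (⇔-sym (Any-∧ᶠ _ _))
  ⊩⇔Any-resolutions (φ ⇒ᵢ ψ) s = ⇔-trans
    (mk⇔ (λ h u u⊆s → to (⊩⇔Any-resolutions ψ u) ∘ h u u⊆s ∘ from (⊩⇔Any-resolutions φ u))
         (λ h u u⊆s → from (⊩⇔Any-resolutions ψ u) ∘ h u u⊆s ∘ to (⊩⇔Any-resolutions φ u)))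
    (Any-implications _ _)
  ⊩⇔Any-resolutions (φ ∨ᵢ ψ) s = ⇔-trans
    (⊩⇔Any-resolutions φ s ⊎-⇔ ⊩⇔Any-resolutions ψ s) (↔⇒⇔ Anyₚ.++↔)
  ⊩⇔Any-resolutions (□ φ) s = ⇔-trans
    (mk⇔ (λ h w sw → to (σ⊩⇔ w) (h w sw)) (λ h w sw → from (σ⊩⇔ w) (h w sw)))
    (Any-singleton _)
    where
    σ⊩⇔ : ∀ w → (σ w ⊩ φ) ⇔ σ w ⊫ resolutions φ
    σ⊩⇔ w = ⇔-trans (⊩⇔Any-resolutions φ (σ w)) (⇔-sym (⊫⇔Any _))
  ⊩⇔Any-resolutions (⊞ φ) s = ⇔-trans
    (mk⇔ (λ h w sw t Σt → to (↑⊩⇔ t) (h w sw t Σt)) (λ h w sw t Σt → from (↑⊩⇔ t) (h w sw t Σt)))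
    (Any-singleton _)
    where
    ↑⊩⇔ : ∀ t → (↑ t ⊩ φ) ⇔ ↑ t ⊫ resolutions φ
    ↑⊩⇔ t = ⇔-trans (⊩⇔Any-resolutions φ (↑ t)) (⇔-sym (⊫⇔Any _))

module _ {I : Set} where

  ⋁ : ∀ {Γ} → List (FO I Γ) → FO I Γ
  ⋁ = foldr _∨ₒ_ ⊥ₒ

  ∀E[_]_ : ∀ {Γ} → Var Γ world → FO I (state ∷ Γ) → FO I Γ
  ∀E[ x ] ψ = ∀ₒ state (Eₐ (vs x) vz ⇒ₒ ψ)

  ∀∈[_]_ : ∀ {Γ} → Var Γ state → FO I (world ∷ Γ) → FO I Γ
  ∀∈[ y ] ψ = ∀ₒ world (∈ₐ vz (vs y) ⇒ₒ ψ)

  mutual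
    st : ∀ {Γ} → Flat I → Var Γ world → FO I Γ
    st (atomᶠ p) x = Pₐ p x
    st ⊥ᶠ        x = ⊥ₒ
    st (a ∧ᶠ b)  x = st a x ∧ₒ st b x
    st (a ⇒ᶠ b)  x = st a x ⇒ₒ st b x
    st (□ᶠ R)    x = stBox R x
    st (⊞ᶠ R)    x = ∀E[ x ] stSome R vz

    -- σ(x) need not be a state of the encoding, so the disjunction over R is
    -- taken outside the quantification over E[x].
    stBox : ∀ {Γ} → List (Flat I) → Var Γ world → FO I Γ
    stBox []      x = ⊥ₒ
    stBox (a ∷ R) x = (∀E[ x ] ∀∈[ vz ] st a vz) ∨ₒ stBox R x

    stSome : ∀ {Γ} → List (Flat I) → Var Γ state → FO I Γ
    stSome []      y = ⊥ₒ
    stSome (a ∷ R) y = (∀∈[ y ] st a vz) ∨ₒ stSome R y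

  worldTranslation : InqForm I → FO I (world ∷ [])
  worldTranslation φ = ⋁ (map (λ a → st a vz) (resolutions φ))

  stateTranslation : InqForm I → FO I (state ∷ [])
  stateTranslation φ = stSome (resolutions φ) vz

module Soundness {I : Set} {M : InqModel I} (𝔐 : Encoding M) where
  open InqModel M
  open Encoding 𝔐
  open FOSem 𝔐
  open FlatSemantics M

  ⋁-sound : ∀ {Γ} (fs : List (FO I Γ)) (ρ : Env Γ) → ⟦ ⋁ fs ⟧ ρ ⇔ Any (λ f → ⟦ f ⟧ ρ) fs
  ⋁-sound []       ρ = mk⇔ (λ ()) (λ ())
  ⋁-sound (f ∷ fs) ρ = ⇔-trans (⇔-refl ⊎-⇔ ⋁-sound fs ρ) (↔⇒⇔ (Anyₚ.∷↔ _))

  ∀E-sound : ∀ {Γ} (x : Var Γ world) ψ (ρ : Env Γ) {P : (W → Set) → Set₁} →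
    (∀ d → ⟦ ψ ⟧ (extend d ρ) ⇔ P (proj₁ d)) →
    ⟦ ∀E[ x ] ψ ⟧ ρ ⇔ (∀ t → Σᵢ (lower (ρ x)) t → P t)
  ∀E-sound x ψ ρ ψ⇔P = mk⇔
    (λ h t Σt → to (ψ⇔P _) (h (t , Σ⊆S _ t Σt) (lift (from (E-spec _ _) Σt))))
    (λ h d (lift Ed) → from (ψ⇔P d) (h (proj₁ d) (to (E-spec _ d) Ed)))

  ∀∈-sound : ∀ {Γ} (y : Var Γ state) ψ (ρ : Env Γ) {P : W → Set₁} →
    (∀ v → ⟦ ψ ⟧ (extend (lift v) ρ) ⇔ P v) →
    ⟦ ∀∈[ y ] ψ ⟧ ρ ⇔ (∀ v → ↑ (proj₁ (ρ y)) v → P v)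
  ∀∈-sound y ψ ρ ψ⇔P = mk⇔
    (λ h v yv → to (ψ⇔P v) (h (lift v) yv))
    (λ h v yv → from (ψ⇔P (lower v)) (h (lower v) yv))

  mutual
    st-sound : ∀ {Γ} a (x : Var Γ world) (ρ : Env Γ) → ⟦ st a x ⟧ ρ ⇔ lower (ρ x) ⊨ᶠ a
    st-sound (atomᶠ p) x ρ = ⇔-refl
    st-sound ⊥ᶠ        x ρ = ⇔-refl
    st-sound (a ∧ᶠ b)  x ρ = st-sound a x ρ ×-⇔ st-sound b x ρ
    st-sound (a ⇒ᶠ b)  x ρ = →-cong-⇔ (st-sound a x ρ) (st-sound b x ρ)
    st-sound (□ᶠ R)    x ρ = stBox-sound R x ρ
    st-sound (⊞ᶠ R)    x ρ = ∀E-sound x (stSome R vz) ρ (λ d → stSome-sound R vz (extend d ρ))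

    stBox-sound : ∀ {Γ} R (x : Var Γ world) (ρ : Env Γ) → ⟦ stBox R x ⟧ ρ ⇔ σ (lower (ρ x)) ⊫ R
    stBox-sound []      x ρ = ⇔-refl
    stBox-sound (a ∷ R) x ρ = ⇔-trans
      (∀E-sound x (∀∈[ vz ] st a vz) ρ λ d →
         ∀∈-sound vz (st a vz) (extend d ρ) λ v → st-sound a vz (extend (lift v) (extend d ρ)))
      (↑Σ⊨ᶠ*⇔σ⊨ᶠ* _ a)
      ⊎-⇔ stBox-sound R x ρ

    stSome-sound : ∀ {Γ} R (y : Var Γ state) (ρ : Env Γ) → ⟦ stSome R y ⟧ ρ ⇔ ↑ (proj₁ (ρ y)) ⊫ R
    stSome-sound []      y ρ = ⇔-refl
    stSome-sound (a ∷ R) y ρ =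
      ∀∈-sound y (st a vz) ρ (λ v → st-sound a vz (extend (lift v) ρ)) ⊎-⇔ stSome-sound R y ρ

  worldTranslation-sound : ∀ φ w → (w ⊨w φ) ⇔ (𝔐 ⊨FO worldTranslation φ [w≔ w ])
  worldTranslation-sound φ w =
    ⇔-trans (⊩⇔Any-resolutions φ (single w))
    (⇔-trans (Any-cong-⇔ (λ a → ⇔-trans (single⊨ᶠ*⇔⊨ᶠ w a) (⇔-sym (st-sound a vz ρ))))
    (⇔-trans (↔⇒⇔ Anyₚ.map↔) (⇔-sym (⋁-sound _ ρ))))
    where
    ρ : Env (world ∷ [])
    ρ = extend (lift w) (λ ())

  stateTranslation-sound : ∀ φ (s : State) →
    (↑ (proj₁ s) ⊩ φ) ⇔ (𝔐 ⊨FO stateTranslation φ [s≔ s ])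
  stateTranslation-sound φ s =
    ⇔-trans (⊩⇔Any-resolutions φ _)
    (⇔-trans (⇔-sym (⊫⇔Any _)) (⇔-sym (stSome-sound _ vz (extend s (λ ())))))

corollary6p9 : {I : Set} (φ : InqForm I) →
    Σ (FO I (world ∷ [])) λ φw → Σ (FO I (state ∷ [])) λ φs →
      (M : InqModel I) (𝔐 : Encoding M) →
        ((w : InqModel.W M) → InqModel._⊨w_ M w φ ⇔ (𝔐 ⊨FO φw [w≔ w ]))
        × ((s : Encoding.State 𝔐) → InqModel._⊩_ M (InqModel.↑ M (proj₁ s)) φ ⇔ (𝔐 ⊨FO φs [s≔ s ]))
corollary6p9 φ = worldTranslation φ , stateTranslation φ , λ M 𝔐 →
  Soundness.worldTranslation-sound 𝔐 φ , Soundness.stateTranslation-sound 𝔐 φ
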